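{- Let $G=(V,E)$ be a directed graph with $V=\omega$, and give $2^\omega$ the product topology in which each factor $2=\{0,1\}$ is discrete. Then every function $f\in\mathfrak{R}(G)$ is continuous (as a map $2^\omega\to 2^\omega$) if and only if $G$ is locally finite, i.e. $|N^+(v)|$ is finite for every $v\in V$.
   Context: A directed graph is a pair $G=(V,E)$ with $V$ a set and $E\subseteq V^2$. For $v\in V$, $N^+(v)=\{w\in V:(v,w)\in E\}$ is the out-neighbourhood of $v$. For $\alpha\in 2^V$ and $I\subseteq V$, let $\alpha^I=\{\beta\in 2^V:\beta(x)=\alpha(x)\text{ for all }x\in V\setminus I\}$. A function $g:2^V\to 2$ is independent of $I\subseteq V$ if $g$ is constant on $\alpha^I$ for every $\alpha\in 2^V$. A function $f:2^V\to 2^V$ respects $G$ if for every $v\in V$ the function $f^v:2^V\to 2$, $f^v(x)=f(x)(v)$, is independent of $V\setminus N^+(v)$. $\mathfrak{R}(G)$ denotes the set of all functions $f:2^V\to 2^V$ respecting $G$. -}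

module Defs where

open import Data.Nat using (ℕ; _<_)
open import Data.Bool using (Bool)
open import Data.List using (List)
open import Data.List.Membership.Propositional using (_∈_)
open import Data.Product using (∃)
open import Relation.Nullary using (¬_)
open import Relation.Binary.PropositionalEquality using (_≡_)

Subset : Set₁
Subset = ℕ → Set

Graph : Set₁
Graph = ℕ → ℕ → Set

Cantor : Set
Cantor = ℕ → Bool

N⁺ : Graph → ℕ → Subset
N⁺ E v w = E v w

Compl : Subset → Subset
Compl I x = ¬ I x

_∈_^_ : Cantor → Cantor → Subset → Set
β ∈ α ^ I = ∀ x → Compl I x → β x ≡ α x

IndependentOf : (Cantor → Bool) → Subset → Set
IndependentOf g I = ∀ α β γ → β ∈ α ^ I → γ ∈ α ^ I → g β ≡ g γ

Respects : Graph → (Cantor → Cantor) → Set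
Respects E f = ∀ v → IndependentOf (λ x → f x v) (Compl (N⁺ E v))

-- Continuity of f : 2^ω → 2^ω for the product topology (2 discrete),
-- expressed via the basic open cylinders: for every point α and output
-- coordinate n there is m such that every β agreeing with α below m
-- satisfies f(β)(n) = f(α)(n).
Continuous : (Cantor → Cantor) → Set
Continuous f = ∀ (α : Cantor) (n : ℕ) → ∃ λ (m : ℕ) →
  ∀ (β : Cantor) → (∀ i → i < m → β i ≡ α i) → f β n ≡ f α n

Finite : Subset → Set
Finite P = ∃ λ (xs : List ℕ) → ∀ w → P w → w ∈ xs

LocallyFinite : Graph → Set
LocallyFinite E = ∀ v → Finite (N⁺ E v)

{-# OPTIONS --safe #-}
module Submission where

-- Under excluded middle, f respects G exactly when f(x)(v) depends only on x restricted to
-- N⁺(v). If N⁺(v) is finite it lies below some m, so agreeing with α below m fixes f(·)(v):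
-- continuity. If N⁺(v) is infinite, "some out-neighbour of v is set" respects G but is
-- discontinuous at the zero sequence: the indicator of [m, ∞) agrees with zero below m,
-- yet meets N⁺(v) for every m.

open import Defs
open import Level using (0ℓ)
open import Axiom.ExcludedMiddle using (ExcludedMiddle)
open import Function.Bundles using (_⇔_; mk⇔)
open import Data.Nat using (ℕ; suc; _<_; _≤_; _≤?_; s≤s)
open import Data.Nat.Properties using (<⇒≱; ≰⇒>)
open import Data.Bool using (true; false)
open import Data.List using (upTo)
open import Data.List.Extrema.Nat using (max; xs≤max)
open import Data.List.Relation.Unary.All as All using ()
open import Data.List.Membership.Propositional.Properties using (∈-upTo⁺)
open import Data.Product using (∃; _×_; _,_)
open import Relation.Nullary using (¬_; does; yes; no; contradiction)
open import Relation.Nullary.Decidable using (decidable-stable; dec-true; dec-false; does-⇔)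
open import Relation.Binary.PropositionalEquality using (_≡_; refl; sym; trans; module ≡-Reasoning)

finite⇒bounded : ∀ {P : Subset} → Finite P → ∃ λ m → ∀ w → P w → w < m
finite⇒bounded (xs , P⊆xs) = suc (max 0 xs) , λ w Pw → s≤s (All.lookup (xs≤max 0 xs) (P⊆xs w Pw))

bounded⇒finite : ∀ {P : Subset} m → (∀ w → P w → w < m) → Finite P
bounded⇒finite m P<m = upTo m , λ w Pw → ∈-upTo⁺ (P<m w Pw)

¬finite⇒unbounded : ExcludedMiddle 0ℓ → ∀ {P : Subset} → ¬ Finite P →
  ∀ m → ∃ λ w → P w × m ≤ w
¬finite⇒unbounded em {P} ¬fin m with em {∃ λ w → P w × m ≤ w}
... | yes unbounded = unbounded
... | no ¬unbounded = contradiction fin ¬fin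
  where
    fin : Finite P
    fin = bounded⇒finite m λ w Pw → ≰⇒> λ m≤w → ¬unbounded (w , Pw , m≤w)

respects⇒local : ExcludedMiddle 0ℓ → ∀ {E f} → Respects E f →
  ∀ v α β → (∀ w → N⁺ E v w → β w ≡ α w) → f β v ≡ f α v
respects⇒local em resp v α β β≡α =
  resp v α β α (λ w ¬¬e → β≡α w (decidable-stable em ¬¬e)) (λ _ _ → refl)

locallyFinite⇒continuous : ExcludedMiddle 0ℓ → ∀ {E} → LocallyFinite E →
  ∀ f → Respects E f → Continuous f
locallyFinite⇒continuous em lf f resp α v with finite⇒bounded (lf v)
... | m , N⁺<m = m , λ β β≡α → respects⇒local em resp v α β λ w e → β≡α w (N⁺<m w e)

zeros : Cantor
zeros _ = false

indicatorFrom : ℕ → Cantor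
indicatorFrom m i = does (m ≤? i)

indicatorFrom-below : ∀ m i → i < m → indicatorFrom m i ≡ zeros i
indicatorFrom-below m i i<m = dec-false (m ≤? i) (<⇒≱ i<m)

module _ (em : ExcludedMiddle 0ℓ) (E : Graph) where

  SomeNeighbourSet : Cantor → ℕ → Set
  SomeNeighbourSet β v = ∃ λ w → E v w × β w ≡ true

  someNeighbourSet : Cantor → Cantor
  someNeighbourSet β v = does (em {SomeNeighbourSet β v})

  someNeighbourSet-respects : Respects E someNeighbourSet
  someNeighbourSet-respects v α β γ β≡α γ≡α = does-⇔ (mk⇔ (move β≡α γ≡α) (move γ≡α β≡α)) em em
    where
      move : ∀ {β γ} → β ∈ α ^ Compl (N⁺ E v) → γ ∈ α ^ Compl (N⁺ E v) →
        SomeNeighbourSet β v → SomeNeighbourSet γ v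
      move β≡α γ≡α (w , e , βw) =
        w , e , trans (γ≡α w (λ ¬e → ¬e e)) (trans (sym (β≡α w (λ ¬e → ¬e e))) βw)

  someNeighbourSet-¬continuous : ∀ v → ¬ Finite (N⁺ E v) → ¬ Continuous someNeighbourSet
  someNeighbourSet-¬continuous v ¬fin cont with cont zeros v
  ... | m , nearZeros with ¬finite⇒unbounded em ¬fin m
  ... | w , e , m≤w = contradiction true≡false λ ()
    where
      open ≡-Reasoning

      atIndicator : someNeighbourSet (indicatorFrom m) v ≡ true
      atIndicator = dec-true em (w , e , dec-true (m ≤? w) m≤w)

      atZeros : someNeighbourSet zeros v ≡ false
      atZeros = dec-false em λ ()

      true≡false : true ≡ false
      true≡false = begin
        true                                   ≡⟨ sym atIndicator ⟩
        someNeighbourSet (indicatorFrom m) v   ≡⟨ nearZeros (indicatorFrom m) (indicatorFrom-below m) ⟩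
        someNeighbourSet zeros v               ≡⟨ atZeros ⟩
        false                                  ∎

lemma3p1 : ExcludedMiddle 0ℓ → (E : Graph) →
    ((∀ (f : Cantor → Cantor) → Respects E f → Continuous f) ⇔ LocallyFinite E)
lemma3p1 em E = mk⇔ continuous⇒locallyFinite (locallyFinite⇒continuous em)
  where
    continuous⇒locallyFinite : (∀ f → Respects E f → Continuous f) → LocallyFinite E
    continuous⇒locallyFinite allContinuous v with em {Finite (N⁺ E v)}
    ... | yes fin = fin
    ... | no ¬fin = contradiction
            (allContinuous (someNeighbourSet em E) (someNeighbourSet-respects em E))
            (someNeighbourSet-¬continuous em E v ¬fin)
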